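{- Let $m$ be a positive integer, let $n_m:=\sum_{s=1}^{m-1}2^s\cdot 2^{2^s}$ (so $n_1=0$), and let $\alpha$ be Levin's binary normal number defined below. Then for every integer $i$ with $0\le i<2^m$ and every integer $B$ with $0\le B<2^{2^m-i}$, for every integer $c$ with $0\le c<2^i$ with the exception of at most $2^{m+1}$ such $c$, we have $$\#\left\{(k,n): 0\le k<2^m,\ B\cdot 2^i\le n<B\cdot 2^i+2^i,\ \left\{2^{n_m+2^m n+k}\alpha\right\}\in\left[\tfrac{c}{2^i},\tfrac{c+1}{2^i}\right)\right\}=2^m.$$
   Context: $\{x\}$ denotes the fractional part of $x$. For nonnegative integers $i,j$ let $p_{i,j}:=\binom{i+j}{j}\bmod 2\in\{0,1\}$. Levin's number $\alpha$ is defined by its binary expansion $\alpha=0.\alpha_1\alpha_2\alpha_3\ldots$, which is the concatenation $\mathcal A_1\mathcal A_2\mathcal A_3\cdots$ of finite 0-1 blocks $\mathcal A_m$ ($m=1,2,\dots$), where $\mathcal A_m$ has $2^m\cdot 2^{2^m}$ digits and is defined as follows. For an integer $n$ with $0\le n<2^{2^m}$ write $n=\sum_{j=0}^{2^m-1}e_j(n)2^j$ with $e_j(n)\in\{0,1\}$, and for $0\le k<2^m$ put $d_k(n):=\sum_{j=0}^{2^m-1}p_{k,j}e_j(n)\bmod 2$. Then $\mathcal A_m$ is the concatenation, for $n=0,1,\dots,2^{2^m}-1$ in this order, of the words $d_0(n)d_1(n)\cdots d_{2^m-1}(n)$. Thus block $\mathcal A_m$ starts with the digit $\alpha_{n_m+1}$.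 -}

module Defs where

open import Data.Nat using (ℕ; zero; suc; _+_; _*_; _∸_; _^_; _<ᵇ_; NonZero)
open import Data.Nat.Properties using (m^n≢0; _≟_)
open import Data.Nat.DivMod using (_/_; _%_)
open import Data.Nat.Combinatorics using (_C_)
open import Data.Bool using (if_then_else_)
open import Data.List using (List; length; filter; upTo; applyUpTo; cartesianProduct)
open import Data.Product using (_×_; _,_)
open import Relation.Nullary using (Dec; ¬?)
open import Relation.Binary.PropositionalEquality using (_≡_)

_/2^_ : ℕ → ℕ → ℕ
n /2^ k = _/_ n (2 ^ k) {{m^n≢0 2 k}}

_%2^_ : ℕ → ℕ → ℕ
n %2^ k = _%_ n (2 ^ k) {{m^n≢0 2 k}}

p : ℕ → ℕ → ℕ
p i j = ((i + j) C j) % 2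

e : ℕ → ℕ → ℕ
e j n = (n /2^ j) % 2

sumTo : ℕ → (ℕ → ℕ) → ℕ
sumTo zero    f = 0
sumTo (suc N) f = sumTo N f + f N

d : ℕ → ℕ → ℕ → ℕ
d m k n = sumTo (2 ^ m) (λ j → p k j * e j n) % 2

blockLen : ℕ → ℕ
blockLen m = 2 ^ m * 2 ^ (2 ^ m)

-- digit at 0-based offset r inside block A_m: word number n = r / 2^m, letter k = r % 2^m
blockDigit : ℕ → ℕ → ℕ
blockDigit m r = d m (r %2^ m) (r /2^ m)

locate : ℕ → ℕ → ℕ → ℕ
locate m r zero    = 0
locate m r (suc f) = if r <ᵇ blockLen m then blockDigit m r else locate (suc m) (r ∸ blockLen m) f

-- digit q = α_{q+1}, the (q+1)-st binary digit of Levin's number α = 0.A_1 A_2 A_3 ...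
digit : ℕ → ℕ
digit q = locate 1 q (suc q)

nm : ℕ → ℕ
nm zero          = 0
nm (suc zero)    = 0
nm (suc (suc k)) = nm (suc k) + blockLen (suc k)

-- window N i = the integer with binary digits α_{N+1} α_{N+2} ... α_{N+i} (most significant first),
-- i.e. floor(2^i {2^N α}).  Hence {2^N α} ∈ [c/2^i,(c+1)/2^i)  iff  window N i ≡ c.
window : ℕ → ℕ → ℕ
window N zero    = 0
window N (suc i) = digit N * 2 ^ i + window (suc N) i

inInterval? : (N i c : ℕ) → Dec (window N i ≡ c)
inInterval? N i c = window N i ≟ c

count : (m i B c : ℕ) → ℕ
count m i B c =
  length (filter (λ kn → inInterval? (nm m + 2 ^ m * Data.Product.proj₂ kn + Data.Product.proj₁ kn) i c)
                 (cartesianProduct (upTo (2 ^ m)) (applyUpTo (λ t → B * 2 ^ i + t) (2 ^ i))))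

exceptions : (m i B : ℕ) → ℕ
exceptions m i B = length (filter (λ c → ¬? (count m i B c ≟ 2 ^ m)) (upTo (2 ^ i)))

-- Write L = 2^m and T = 2^i, and let f_k(t) < T be the window of i digits of α that starts at
-- letter k of the word of n = B·T + t.  For each k, f_k is injective on t < T − 1.  If the
-- window lies inside the word of n, its letters d_k(n), …, d_(k+i−1)(n) together with the high
-- part ⌊n/T⌋ = B determine n.  Otherwise it consists of the last a letters of n, which determine
-- n mod 2^a and hence (n+1) mod 2^a, followed by the first letters of n+1, which then determine
-- n+1 (whose high part is still B as long as t + 1 < T).  Both facts come from Pascal's rule,
-- d_(k+1)(n) ≡ d_k(n) + d_(k+1)(⌊n/2⌋) (mod 2), which recovers n one binary digit at a time, and
-- from Lucas's theorem, by which C(k+j, j) is even when k, j < L ≤ k + j.  A map from [0,T) to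
-- itself that is injective on [0,T−1) has all fibres of size 1 except at most two, and a c whose
-- count differs from L is such an exceptional value for some k: so there are at most 2L of them.

module Submission where

open import Defs
open import Data.Nat using (ℕ; _+_; _^_; _≤_; _<_; _∸_)

import Data.Bool as Bool
open import Data.Bool using (true; false; if_then_else_)
open import Data.Empty using (⊥-elim)
open import Data.List using (List; []; [_]; _++_; length; filter; map; applyUpTo; cartesianProduct)
open import Data.List.Properties
  using (length-++; filter-++; applyUpTo-∷ʳ; map-applyUpTo; ++-identityʳ; cartesianProductWith-distribʳ-++)
open import Data.Nat
open import Data.Nat.Combinatorics using (_C_; nCn≡1; nC1≡n; nCk+nC[k+1]≡[n+1]C[k+1])
open import Data.Nat.DivMod
open import Data.Nat.Divisibility using (m∣m*n; n∣m*n)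
open import Data.Nat.Properties
open import Data.Nat.Tactic.RingSolver using (solve-∀)
open import Algebra.Properties.CommutativeSemigroup +-commutativeSemigroup
  using () renaming (interchange to +-interchange)
open import Data.Parity.Base using (Parity; 0ℙ) renaming (_+_ to infixl 6 _⊕_; _*_ to _⊗_)
import Data.Parity.Properties as ℙ
open import Data.Product using (_×_; _,_; proj₁; proj₂)
open import Data.Unit using (tt)
open import Relation.Binary.PropositionalEquality using (_≡_; refl; sym; trans; cong; cong₂; subst; module ≡-Reasoning)
open import Relation.Nullary using (Dec; yes; no; does; ¬_; ¬?; contradiction)
open import Relation.Unary using (Pred; Decidable)

parity[2*n]≡0ℙ : ∀ n → parity (2 * n) ≡ 0ℙ
parity[2*n]≡0ℙ n = trans (ℙ.*-homo-* 2 n) (ℙ.*-zeroˡ (parity n))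

parity-%2 : ∀ n → parity (n % 2) ≡ parity n
parity-%2 n = begin
  parity (n % 2)                        ≡⟨ ℙ.+-identityʳ (parity (n % 2)) ⟨
  parity (n % 2) ⊕ 0ℙ                   ≡⟨ cong (parity (n % 2) ⊕_) (parity[2*n]≡0ℙ (n / 2)) ⟨
  parity (n % 2) ⊕ parity (2 * (n / 2)) ≡⟨ ℙ.+-homo-+ (n % 2) (2 * (n / 2)) ⟨
  parity (n % 2 + 2 * (n / 2))          ≡⟨ cong (λ q → parity (n % 2 + q)) (*-comm 2 (n / 2)) ⟩
  parity (n % 2 + n / 2 * 2)            ≡⟨ cong parity (m≡m%n+[m/n]*n n 2) ⟨
  parity n                              ∎
  where open ≡-Reasoning

parity-injective-<2 : ∀ {a b} → a < 2 → b < 2 → parity a ≡ parity b → a ≡ b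
parity-injective-<2 {0}           {0}           _                _                _  = refl
parity-injective-<2 {1}           {1}           _                _                _  = refl
parity-injective-<2 {0}           {1}           _                _                ()
parity-injective-<2 {1}           {0}           _                _                ()
parity-injective-<2 {suc (suc _)} {_}           (s≤s (s≤s ())) _                _
parity-injective-<2 {_}           {suc (suc _)} _                (s≤s (s≤s ())) _

parity≡⇒%2≡ : ∀ {x y} → parity x ≡ parity y → x % 2 ≡ y % 2
parity≡⇒%2≡ {x} {y} eq = parity-injective-<2 (m%n<n x 2) (m%n<n y 2)
  (trans (parity-%2 x) (trans eq (sym (parity-%2 y))))

parity≡∧/2≡⇒≡ : ∀ {x y} → parity x ≡ parity y → x / 2 ≡ y / 2 → x ≡ y
parity≡∧/2≡⇒≡ {x} {y} bit half = begin
  x                 ≡⟨ m≡m%n+[m/n]*n x 2 ⟩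
  x % 2 + x / 2 * 2 ≡⟨ cong₂ (λ b h → b + h * 2) (parity≡⇒%2≡ {x} {y} bit) half ⟩
  y % 2 + y / 2 * 2 ≡⟨ m≡m%n+[m/n]*n y 2 ⟨
  y                 ∎
  where open ≡-Reasoning

parity-*-congˡ : ∀ c a b → parity a ≡ parity b → parity (c * a) ≡ parity (c * b)
parity-*-congˡ c a b eq = trans (ℙ.*-homo-* c a) (trans (cong (parity c ⊗_) eq) (sym (ℙ.*-homo-* c b)))

parity-*-congʳ : ∀ c a b → parity a ≡ parity b → parity (a * c) ≡ parity (b * c)
parity-*-congʳ c a b eq = trans (ℙ.*-homo-* a c) (trans (cong (_⊗ parity c) eq) (sym (ℙ.*-homo-* b c)))

-- Binomial coefficients modulo 2

parity-pascal : ∀ n k → parity (suc n C suc k) ≡ parity (n C k) ⊕ parity (n C suc k)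
parity-pascal n k = trans (cong parity (sym (nCk+nC[k+1]≡[n+1]C[k+1] n k))) (ℙ.+-homo-+ (n C k) (n C suc k))

parity-pascal₂ : ∀ n k → parity (suc (suc n) C suc (suc k)) ≡ parity (n C k) ⊕ parity (n C suc (suc k))
parity-pascal₂ n k = begin
  parity (suc (suc n) C suc (suc k))                    ≡⟨ parity-pascal (suc n) (suc k) ⟩
  parity (suc n C suc k) ⊕ parity (suc n C suc (suc k)) ≡⟨ cong₂ _⊕_ (parity-pascal n k) (parity-pascal n (suc k)) ⟩
  (a ⊕ b) ⊕ (b ⊕ c)                                     ≡⟨ ℙ.+-assoc a b (b ⊕ c) ⟩
  a ⊕ (b ⊕ (b ⊕ c))                                     ≡⟨ cong (a ⊕_) (ℙ.+-assoc b b c) ⟨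
  a ⊕ ((b ⊕ b) ⊕ c)                                     ≡⟨ cong (λ q → a ⊕ (q ⊕ c)) (ℙ.p+p≡0ℙ b) ⟩
  a ⊕ c                                                 ∎
  where
  open ≡-Reasoning
  a b c : Parity
  a = parity (n C k)
  b = parity (n C suc k)
  c = parity (n C suc (suc k))

-- Lucas's theorem modulo 2, one binary digit at a time.
C-even-odd  : ∀ a c → parity ((2 * a) C suc (2 * c)) ≡ 0ℙ
C-even-even : ∀ a c → parity ((2 * a) C (2 * c)) ≡ parity (a C c)

C-even-odd zero    c       = refl
C-even-odd (suc a) zero    = trans (cong parity (nC1≡n (2 * suc a))) (parity[2*n]≡0ℙ (suc a))
C-even-odd (suc a) (suc c) = begin
  parity ((2 * suc a) C suc (2 * suc c))
    ≡⟨ cong₂ (λ n k → parity (n C suc k)) (*-suc 2 a) (*-suc 2 c) ⟩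
  parity (suc (suc (2 * a)) C suc (suc (suc (2 * c))))
    ≡⟨ parity-pascal₂ (2 * a) (suc (2 * c)) ⟩
  parity ((2 * a) C suc (2 * c)) ⊕ parity ((2 * a) C suc (suc (suc (2 * c))))
    ≡⟨ cong (λ k → parity ((2 * a) C suc (2 * c)) ⊕ parity ((2 * a) C suc k)) (*-suc 2 c) ⟨
  parity ((2 * a) C suc (2 * c)) ⊕ parity ((2 * a) C suc (2 * suc c))
    ≡⟨ cong₂ _⊕_ (C-even-odd a c) (C-even-odd a (suc c)) ⟩
  0ℙ
    ∎
  where open ≡-Reasoning

C-even-even zero    zero    = refl
C-even-even zero    (suc c) = cong (λ k → parity (0 C k)) (*-suc 2 c)
C-even-even (suc a) zero    = cong (λ n → parity (n C 0)) (*-suc 2 a)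
C-even-even (suc a) (suc c) = begin
  parity ((2 * suc a) C (2 * suc c))
    ≡⟨ cong₂ (λ n k → parity (n C k)) (*-suc 2 a) (*-suc 2 c) ⟩
  parity (suc (suc (2 * a)) C suc (suc (2 * c)))
    ≡⟨ parity-pascal₂ (2 * a) (2 * c) ⟩
  parity ((2 * a) C (2 * c)) ⊕ parity ((2 * a) C suc (suc (2 * c)))
    ≡⟨ cong (λ k → parity ((2 * a) C (2 * c)) ⊕ parity ((2 * a) C k)) (*-suc 2 c) ⟨
  parity ((2 * a) C (2 * c)) ⊕ parity ((2 * a) C (2 * suc c))
    ≡⟨ cong₂ _⊕_ (C-even-even a c) (C-even-even a (suc c)) ⟩
  parity (a C c) ⊕ parity (a C suc c)
    ≡⟨ parity-pascal a c ⟨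
  parity (suc a C suc c)
    ∎
  where open ≡-Reasoning

C-odd-even : ∀ a c → parity (suc (2 * a) C (2 * c)) ≡ parity (a C c)
C-odd-even a zero    = refl
C-odd-even a (suc c) = begin
  parity (suc (2 * a) C (2 * suc c))
    ≡⟨ cong (λ k → parity (suc (2 * a) C k)) (*-suc 2 c) ⟩
  parity (suc (2 * a) C suc (suc (2 * c)))
    ≡⟨ parity-pascal (2 * a) (suc (2 * c)) ⟩
  parity ((2 * a) C suc (2 * c)) ⊕ parity ((2 * a) C suc (suc (2 * c)))
    ≡⟨ cong₂ (λ q k → q ⊕ parity ((2 * a) C k)) (C-even-odd a c) (sym (*-suc 2 c)) ⟩
  parity ((2 * a) C (2 * suc c))
    ≡⟨ C-even-even a (suc c) ⟩
  parity (a C suc c)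
    ∎
  where open ≡-Reasoning

C-odd-odd : ∀ a c → parity (suc (2 * a) C suc (2 * c)) ≡ parity (a C c)
C-odd-odd a c = begin
  parity (suc (2 * a) C suc (2 * c))                        ≡⟨ parity-pascal (2 * a) (2 * c) ⟩
  parity ((2 * a) C (2 * c)) ⊕ parity ((2 * a) C suc (2 * c)) ≡⟨ cong₂ _⊕_ (C-even-even a c) (C-even-odd a c) ⟩
  parity (a C c) ⊕ 0ℙ                                       ≡⟨ ℙ.+-identityʳ _ ⟩
  parity (a C c)                                            ∎
  where open ≡-Reasoning

data Halving : ℕ → Set where
  even : ∀ h → Halving (2 * h)
  odd  : ∀ h → Halving (suc (2 * h))

halving : ∀ n → Halving n
halving zero    = even 0
halving (suc n) with halving n
... | even h = odd h
... | odd h  = subst Halving (*-suc 2 h) (even (suc h))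

halve-carry : ∀ {M} h g → 2 * M ≤ suc (2 * h + 2 * g) → M ≤ h + g
halve-carry {M} h g le = ≮⇒≥ λ h+g<M → 1+n≰n (≤-trans (subst (_≤ 2 * M) 2[1+h+g] (*-monoʳ-≤ 2 h+g<M)) le)
  where
  2[1+h+g] : 2 * suc (h + g) ≡ suc (suc (2 * h + 2 * g))
  2[1+h+g] = trans (*-suc 2 (h + g)) (cong (λ n → suc (suc n)) (*-distribˡ-+ 2 h g))

1+2*m<2*n⇒m<n : ∀ {m n} → suc (2 * m) < 2 * n → m < n
1+2*m<2*n⇒m<n lt = *-cancelˡ-< 2 _ _ (<-trans (n<1+n _) lt)

-- Kummer's theorem for a carry out of the top binary digit.
binom-carry : ∀ m r j → r < 2 ^ m → j < 2 ^ m → 2 ^ m ≤ r + j → parity ((r + j) C j) ≡ 0ℙ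
binom-carry zero    _ _ (s≤s z≤n) (s≤s z≤n) ()
binom-carry (suc m) r j r< j< carry with halving r | halving j
... | even h | even g = begin
  parity ((2 * h + 2 * g) C (2 * g)) ≡⟨ cong (λ n → parity (n C (2 * g))) (*-distribˡ-+ 2 h g) ⟨
  parity ((2 * (h + g)) C (2 * g))   ≡⟨ C-even-even (h + g) g ⟩
  parity ((h + g) C g)
    ≡⟨ binom-carry m h g (*-cancelˡ-< 2 _ _ r<) (*-cancelˡ-< 2 _ _ j<) (halve-carry h g (m≤n⇒m≤1+n carry)) ⟩
  0ℙ                                 ∎
  where open ≡-Reasoning
... | odd h | even g = begin
  parity (suc (2 * h + 2 * g) C (2 * g)) ≡⟨ cong (λ n → parity (suc n C (2 * g))) (*-distribˡ-+ 2 h g) ⟨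
  parity (suc (2 * (h + g)) C (2 * g))   ≡⟨ C-odd-even (h + g) g ⟩
  parity ((h + g) C g)
    ≡⟨ binom-carry m h g (1+2*m<2*n⇒m<n r<) (*-cancelˡ-< 2 _ _ j<) (halve-carry h g carry) ⟩
  0ℙ                                   ∎
  where open ≡-Reasoning
... | even h | odd g = begin
  parity ((2 * h + suc (2 * g)) C suc (2 * g)) ≡⟨ cong (λ n → parity (n C suc (2 * g))) (+-suc (2 * h) (2 * g)) ⟩
  parity (suc (2 * h + 2 * g) C suc (2 * g))   ≡⟨ cong (λ n → parity (suc n C suc (2 * g))) (*-distribˡ-+ 2 h g) ⟨
  parity (suc (2 * (h + g)) C suc (2 * g))     ≡⟨ C-odd-odd (h + g) g ⟩
  parity ((h + g) C g)
    ≡⟨ binom-carry m h g (*-cancelˡ-< 2 _ _ r<) (1+2*m<2*n⇒m<n j<)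
         (halve-carry h g (subst (2 ^ suc m ≤_) (+-suc (2 * h) (2 * g)) carry)) ⟩
  0ℙ                                           ∎
  where open ≡-Reasoning
... | odd h | odd g = begin
  parity (suc (2 * h + suc (2 * g)) C suc (2 * g)) ≡⟨ cong (λ n → parity (n C suc (2 * g))) 2[1+h+g] ⟨
  parity ((2 * suc (h + g)) C suc (2 * g))         ≡⟨ C-even-odd (suc (h + g)) g ⟩
  0ℙ                                               ∎
  where
  open ≡-Reasoning
  2[1+h+g] : 2 * suc (h + g) ≡ suc (2 * h + suc (2 * g))
  2[1+h+g] = trans (*-suc 2 (h + g)) (cong suc (trans (cong suc (*-distribˡ-+ 2 h g)) (sym (+-suc (2 * h) (2 * g)))))

sumTo-cong : ∀ J (f g : ℕ → ℕ) → (∀ j → j < J → f j ≡ g j) → sumTo J f ≡ sumTo J g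
sumTo-cong zero    f g _  = refl
sumTo-cong (suc J) f g eq = cong₂ _+_ (sumTo-cong J f g (λ j j<J → eq j (m<n⇒m<1+n j<J))) (eq J (n<1+n J))

sumTo-mono : ∀ J (f g : ℕ → ℕ) → (∀ j → j < J → f j ≤ g j) → sumTo J f ≤ sumTo J g
sumTo-mono zero    f g _  = z≤n
sumTo-mono (suc J) f g le = +-mono-≤ (sumTo-mono J f g (λ j j<J → le j (m<n⇒m<1+n j<J))) (le J (n<1+n J))

sumTo-+ : ∀ J (f g : ℕ → ℕ) → sumTo J (λ j → f j + g j) ≡ sumTo J f + sumTo J g
sumTo-+ zero    f g = refl
sumTo-+ (suc J) f g = trans (cong (_+ (f J + g J)) (sumTo-+ J f g)) (+-interchange (sumTo J f) (sumTo J g) (f J) (g J))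

sumTo-const : ∀ J c → sumTo J (λ _ → c) ≡ J * c
sumTo-const zero    c = refl
sumTo-const (suc J) c = trans (cong (_+ c) (sumTo-const J c)) (+-comm (J * c) c)

sumTo-zero : ∀ J (f : ℕ → ℕ) → (∀ j → j < J → f j ≡ 0) → sumTo J f ≡ 0
sumTo-zero J f eq = trans (sumTo-cong J f (λ _ → 0) eq) (trans (sumTo-const J 0) (*-zeroʳ J))

sumTo-swap : ∀ I J (h : ℕ → ℕ → ℕ) → sumTo I (λ i → sumTo J (h i)) ≡ sumTo J (λ j → sumTo I (λ i → h i j))
sumTo-swap zero    J h = sym (sumTo-zero J _ (λ _ _ → refl))
sumTo-swap (suc I) J h = trans (cong (_+ sumTo J (h I)) (sumTo-swap I J h))
                               (sym (sumTo-+ J (λ j → sumTo I (λ i → h i j)) (h I)))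

sumTo-head : ∀ J (f : ℕ → ℕ) → sumTo (suc J) f ≡ f 0 + sumTo J (λ j → f (suc j))
sumTo-head zero    f = +-comm 0 (f 0)
sumTo-head (suc J) f = trans (cong (_+ f (suc J)) (sumTo-head J f)) (+-assoc (f 0) _ _)

parity-sumTo-cong : ∀ J (f g : ℕ → ℕ) → (∀ j → j < J → parity (f j) ≡ parity (g j)) →
                    parity (sumTo J f) ≡ parity (sumTo J g)
parity-sumTo-cong zero    f g _  = refl
parity-sumTo-cong (suc J) f g eq = begin
  parity (sumTo J f + f J)          ≡⟨ ℙ.+-homo-+ (sumTo J f) (f J) ⟩
  parity (sumTo J f) ⊕ parity (f J)
    ≡⟨ cong₂ _⊕_ (parity-sumTo-cong J f g (λ j j<J → eq j (m<n⇒m<1+n j<J))) (eq J (n<1+n J)) ⟩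
  parity (sumTo J g) ⊕ parity (g J) ≡⟨ ℙ.+-homo-+ (sumTo J g) (g J) ⟨
  parity (sumTo J g + g J)          ∎
  where open ≡-Reasoning

m<n⇒m/2<n : ∀ {x N} → x < N → x / 2 < N
m<n⇒m/2<n {x} x< = ≤-<-trans (m/n≤m x 2) x<

m<2^[1+n]⇒m/2<2^n : ∀ J {x} → x < 2 ^ suc J → x / 2 < 2 ^ J
m<2^[1+n]⇒m/2<2^n J {x} x< = m<n*o⇒m/o<n (subst (x <_) (*-comm 2 (2 ^ J)) x<)

[m*n+o]%n≡o : ∀ a N {w} .{{_ : NonZero N}} → w < N → (a * N + w) % N ≡ w
[m*n+o]%n≡o a N {w} w<N = trans (cong (_% N) (+-comm (a * N) w)) (trans ([m+kn]%n≡m%n w a N) (m<n⇒m%n≡m w<N))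

[m*n+o]/n≡m : ∀ a N {w} .{{_ : NonZero N}} → w < N → (a * N + w) / N ≡ a
[m*n+o]/n≡m a N {w} w<N = begin
  (a * N + w) / N   ≡⟨ cong (_/ N) (+-comm (a * N) w) ⟩
  (w + a * N) / N   ≡⟨ +-distrib-/-∣ʳ w (n∣m*n a) ⟩
  w / N + a * N / N ≡⟨ cong₂ _+_ (m<n⇒m/n≡0 w<N) (m*n/n≡m a N) ⟩
  a                 ∎
  where open ≡-Reasoning

[m*n+o]-injective : ∀ N {a a' w w'} .{{_ : NonZero N}} → w < N → w' < N →
                    a * N + w ≡ a' * N + w' → a ≡ a' × w ≡ w'
[m*n+o]-injective N {a} {a'} {w} {w'} w< w'< eq =
    trans (sym ([m*n+o]/n≡m a N w<)) (trans (cong (_/ N) eq) ([m*n+o]/n≡m a' N w'<))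
  , trans (sym ([m*n+o]%n≡o a N w<)) (trans (cong (_% N) eq) ([m*n+o]%n≡o a' N w'<))

/2^-suc : ∀ x j → x /2^ suc j ≡ (x / 2) /2^ j
/2^-suc x j = sym (m/n/o≡m/[n*o] x 2 (2 ^ j) {{_}} {{m^n≢0 2 j}} {{m^n≢0 2 (suc j)}})

/2^-suc-cong : ∀ j {x y} → x /2^ suc j ≡ y /2^ suc j → (x / 2) /2^ j ≡ (y / 2) /2^ j
/2^-suc-cong j {x} {y} eq = trans (sym (/2^-suc x j)) (trans eq (/2^-suc y j))

parity-e-zero : ∀ x → parity (e 0 x) ≡ parity x
parity-e-zero x = trans (parity-%2 (x / 1)) (cong parity (n/1≡n x))

e-suc : ∀ j x → e (suc j) x ≡ e j (x / 2)
e-suc j x = cong (_% 2) (/2^-suc x j)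

e-high : ∀ j x → x < 2 ^ j → e j x ≡ 0
e-high j x x< = cong (_% 2) (m<n⇒m/n≡0 {{m^n≢0 2 j}} x<)

%2^-suc-%2 : ∀ a x → x %2^ suc a % 2 ≡ x % 2
%2^-suc-%2 a x = m∣n⇒o%n%m≡o%m 2 (2 ^ suc a) x {{_}} {{m^n≢0 2 (suc a)}} (m∣m*n (2 ^ a))

%2^-suc-/2 : ∀ a x → x %2^ suc a / 2 ≡ (x / 2) %2^ a
%2^-suc-/2 a x = trans (cong (_/ 2) x%2^[1+a]) (m%[n*o]/o≡m/o%n x (2 ^ a) 2 {{m^n≢0 2 a}} {{_}} {{2^a*2≢0}})
  where
  2^a*2≢0 : NonZero (2 ^ a * 2)
  2^a*2≢0 = m*n≢0 (2 ^ a) 2 {{m^n≢0 2 a}}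
  x%2^[1+a] : x %2^ suc a ≡ _%_ x (2 ^ a * 2) {{2^a*2≢0}}
  x%2^[1+a] = %-congʳ {{m^n≢0 2 (suc a)}} {{2^a*2≢0}} (*-comm 2 (2 ^ a))

parity-%2^-suc : ∀ a x → parity (x %2^ suc a) ≡ parity x
parity-%2^-suc a x = trans (sym (parity-%2 (x %2^ suc a))) (trans (cong parity (%2^-suc-%2 a x)) (parity-%2 x))

%2^-suc-split : ∀ a {x y} → x %2^ suc a ≡ y %2^ suc a → parity x ≡ parity y × (x / 2) %2^ a ≡ (y / 2) %2^ a
%2^-suc-split a {x} {y} eq =
    trans (sym (parity-%2^-suc a x)) (trans (cong parity eq) (parity-%2^-suc a y))
  , trans (sym (%2^-suc-/2 a x)) (trans (cong (_/ 2) eq) (%2^-suc-/2 a y))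

%2^-suc-join : ∀ a {x y} → parity x ≡ parity y → (x / 2) %2^ a ≡ (y / 2) %2^ a → x %2^ suc a ≡ y %2^ suc a
%2^-suc-join a {x} {y} bit high = parity≡∧/2≡⇒≡
  (trans (parity-%2^-suc a x) (trans bit (sym (parity-%2^-suc a y))))
  (trans (%2^-suc-/2 a x) (trans high (sym (%2^-suc-/2 a y))))

%2^-cong-suc : ∀ a {x y} → x %2^ a ≡ y %2^ a → suc x %2^ a ≡ suc y %2^ a
%2^-cong-suc a {x} {y} eq = begin
  (1 + x) % 2^a             ≡⟨ %-distribˡ-+ 1 x 2^a ⟩
  (1 % 2^a + x % 2^a) % 2^a ≡⟨ cong (λ r → (1 % 2^a + r) % 2^a) eq ⟩
  (1 % 2^a + y % 2^a) % 2^a ≡⟨ %-distribˡ-+ 1 y 2^a ⟨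
  (1 + y) % 2^a             ∎
  where
  open ≡-Reasoning
  2^a : ℕ
  2^a = 2 ^ a
  instance
    2^a≢0 : NonZero 2^a
    2^a≢0 = m^n≢0 2 a

e-cong-%2^ : ∀ a {x y} → x %2^ a ≡ y %2^ a → ∀ j → j < a → parity (e j x) ≡ parity (e j y)
e-cong-%2^ (suc a) {x} {y} eq zero    _         =
  trans (parity-e-zero x) (trans (proj₁ (%2^-suc-split a eq)) (sym (parity-e-zero y)))
e-cong-%2^ (suc a) {x} {y} eq (suc j) (s≤s j<a) =
  trans (cong parity (e-suc j x)) (trans (e-cong-%2^ a (proj₂ (%2^-suc-split a eq)) j j<a) (cong parity (sym (e-suc j y))))

letter : ℕ → ℕ → ℕ → Parity
letter J k x = parity (sumTo J (λ j → p k j * e j x))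

parity-d : ∀ m k x → parity (d m k x) ≡ letter (2 ^ m) k x
parity-d m k x = parity-%2 (sumTo (2 ^ m) (λ j → p k j * e j x))

tailSum : ℕ → ℕ → ℕ → ℕ
tailSum J k z = sumTo J (λ j → p k (suc j) * e j z)

parity-p : ∀ k j → parity (p k j) ≡ parity ((k + j) C j)
parity-p k j = parity-%2 ((k + j) C j)

p-pascal : ∀ k j → parity (p (suc k) (suc j)) ≡ parity (p k (suc j) + p (suc k) j)
p-pascal k j = begin
  parity (p (suc k) (suc j))                              ≡⟨ parity-p (suc k) (suc j) ⟩
  parity (suc (k + suc j) C suc j)                        ≡⟨ parity-pascal (k + suc j) j ⟩
  parity ((k + suc j) C j) ⊕ parity ((k + suc j) C suc j) ≡⟨ ℙ.+-comm (parity ((k + suc j) C j)) _ ⟩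
  parity ((k + suc j) C suc j) ⊕ parity ((k + suc j) C j) ≡⟨ cong₂ _⊕_ (sym (parity-p k (suc j))) shifted ⟩
  parity (p k (suc j)) ⊕ parity (p (suc k) j)             ≡⟨ ℙ.+-homo-+ (p k (suc j)) (p (suc k) j) ⟨
  parity (p k (suc j) + p (suc k) j)                      ∎
  where
  open ≡-Reasoning
  shifted : parity ((k + suc j) C j) ≡ parity (p (suc k) j)
  shifted = trans (cong (λ n → parity (n C j)) (+-suc k j)) (sym (parity-p (suc k) j))

letter-head : ∀ J k x → letter (suc J) k x ≡ parity x ⊕ parity (tailSum J k (x / 2))
letter-head J k x = begin
  letter (suc J) k x                                                  ≡⟨ cong parity (sumTo-head J _) ⟩
  parity (p k 0 * e 0 x + sumTo J (λ j → p k (suc j) * e (suc j) x)) ≡⟨ ℙ.+-homo-+ (p k 0 * e 0 x) _ ⟩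
  parity (p k 0 * e 0 x) ⊕ parity (sumTo J (λ j → p k (suc j) * e (suc j) x))
    ≡⟨ cong₂ _⊕_ (trans (ℙ.*-homo-* (p k 0) (e 0 x)) (parity-e-zero x))
                 (cong parity (sumTo-cong J _ _ (λ j _ → cong (p k (suc j) *_) (e-suc j x)))) ⟩
  parity x ⊕ parity (tailSum J k (x / 2))                             ∎
  where open ≡-Reasoning

tailSum-suc : ∀ J k z → parity (tailSum J (suc k) z) ≡ parity (tailSum J k z) ⊕ letter J (suc k) z
tailSum-suc J k z = begin
  parity (tailSum J (suc k) z)
    ≡⟨ parity-sumTo-cong J _ (λ j → p k (suc j) * e j z + p (suc k) j * e j z) pascal-term ⟩
  parity (sumTo J (λ j → p k (suc j) * e j z + p (suc k) j * e j z))
    ≡⟨ cong parity (sumTo-+ J _ _) ⟩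
  parity (tailSum J k z + sumTo J (λ j → p (suc k) j * e j z))
    ≡⟨ ℙ.+-homo-+ (tailSum J k z) _ ⟩
  parity (tailSum J k z) ⊕ letter J (suc k) z
    ∎
  where
  open ≡-Reasoning
  pascal-term : ∀ j → j < J → parity (p (suc k) (suc j) * e j z) ≡ parity (p k (suc j) * e j z + p (suc k) j * e j z)
  pascal-term j _ = trans (parity-*-congʳ (e j z) (p (suc k) (suc j)) (p k (suc j) + p (suc k) j) (p-pascal k j))
                          (cong parity (*-distribʳ-+ (e j z) (p k (suc j)) (p (suc k) j)))

tailSum-zero : ∀ J z → parity (tailSum J 0 z) ≡ letter J 0 z
tailSum-zero J z =
  cong parity (sumTo-cong J _ _ (λ j _ → cong (λ n → n % 2 * e j z) (trans (nCn≡1 (suc j)) (sym (nCn≡1 j)))))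

letter-last : ∀ J k z → z < 2 ^ J → letter (suc J) k z ≡ letter J k z
letter-last J k z z< = cong parity (begin
  S + p k J * e J z ≡⟨ cong (λ b → S + p k J * b) (e-high J z z<) ⟩
  S + p k J * 0     ≡⟨ cong (S +_) (*-zeroʳ (p k J)) ⟩
  S + 0             ≡⟨ +-identityʳ S ⟩
  S                 ∎)
  where
  open ≡-Reasoning
  S : ℕ
  S = sumTo J (λ j → p k j * e j z)

letter-suc : ∀ J k x → x < 2 ^ suc J → letter (suc J) (suc k) x ≡ letter (suc J) k x ⊕ letter (suc J) (suc k) (x / 2)
letter-suc J k x x< = begin
  letter (suc J) (suc k) x                                             ≡⟨ letter-head J (suc k) x ⟩
  parity x ⊕ parity (tailSum J (suc k) (x / 2))                        ≡⟨ cong (parity x ⊕_) (tailSum-suc J k (x / 2)) ⟩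
  parity x ⊕ (parity (tailSum J k (x / 2)) ⊕ letter J (suc k) (x / 2)) ≡⟨ ℙ.+-assoc (parity x) _ _ ⟨
  (parity x ⊕ parity (tailSum J k (x / 2))) ⊕ letter J (suc k) (x / 2)
    ≡⟨ cong₂ _⊕_ (sym (letter-head J k x)) (sym (letter-last J (suc k) (x / 2) (m<2^[1+n]⇒m/2<2^n J x<))) ⟩
  letter (suc J) k x ⊕ letter (suc J) (suc k) (x / 2)                  ∎
  where open ≡-Reasoning

letter-zero : ∀ J x → x < 2 ^ suc J → letter (suc J) 0 x ≡ parity x ⊕ letter (suc J) 0 (x / 2)
letter-zero J x x< = begin
  letter (suc J) 0 x                      ≡⟨ letter-head J 0 x ⟩
  parity x ⊕ parity (tailSum J 0 (x / 2)) ≡⟨ cong (parity x ⊕_) (tailSum-zero J (x / 2)) ⟩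
  parity x ⊕ letter J 0 (x / 2)           ≡⟨ cong (parity x ⊕_) (letter-last J 0 (x / 2) (m<2^[1+n]⇒m/2<2^n J x<)) ⟨
  parity x ⊕ letter (suc J) 0 (x / 2)     ∎
  where open ≡-Reasoning

-- By Kummer's theorem p k (j + 1) is even once k + j + 1 ≥ 2 ^ m, so only the low a bits of z count.
tailSum-low : ∀ m J k a {z z'} → J < 2 ^ m → k + suc a ≡ 2 ^ m → z %2^ a ≡ z' %2^ a →
              parity (tailSum J k z) ≡ parity (tailSum J k z')
tailSum-low m J k a {z} {z'} J< k+a+1≡ low = parity-sumTo-cong J _ _ term
  where
  term : ∀ j → j < J → parity (p k (suc j) * e j z) ≡ parity (p k (suc j) * e j z')
  term j j<J with j <? a
  ... | yes j<a = parity-*-congˡ (p k (suc j)) (e j z) (e j z') (e-cong-%2^ a low j j<a)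
  ... | no  j≮a = trans (parity-*-congʳ (e j z) (p k (suc j)) 0 p≡0)
                        (sym (parity-*-congʳ (e j z') (p k (suc j)) 0 p≡0))
    where
    p≡0 : parity (p k (suc j)) ≡ parity 0
    p≡0 = trans (parity-p k (suc j)) (binom-carry m k (suc j)
            (subst (k <_) k+a+1≡ (m<m+n k z<s))
            (≤-<-trans j<J J<)
            (subst (_≤ k + suc j) k+a+1≡ (+-monoʳ-≤ k (s≤s (≮⇒≥ j≮a)))))

-- Recovering a word from some of its letters

-- Pascal's rule (letter-suc, letter-zero) turns agreeing letters of x and y into agreeing letters
-- of ⌊x/2⌋ and ⌊y/2⌋, and letter-head then yields agreement of the lowest bits: so x and y can be
-- compared one binary digit at a time.
module _ (J : ℕ) where

  open ≡-Reasoning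

  LettersAgree : ℕ → ℕ → ℕ → ℕ → Set
  LettersAgree k n x y = ∀ u → u < n → letter (suc J) (k + u) x ≡ letter (suc J) (k + u) y

  LettersAgree-/2 : ∀ k n {x y} → x < 2 ^ suc J → y < 2 ^ suc J →
                    LettersAgree k (suc n) x y → LettersAgree (suc k) n (x / 2) (y / 2)
  LettersAgree-/2 k n {x} {y} x< y< agree u u<n = ℙ.+-cancelˡ-≡ (letter (suc J) (k + u) x) _ _ (begin
    letter (suc J) (k + u) x ⊕ letter (suc J) (suc (k + u)) (x / 2) ≡⟨ letter-suc J (k + u) x x< ⟨
    letter (suc J) (suc (k + u)) x                                  ≡⟨ shifted ⟩
    letter (suc J) (suc (k + u)) y                                  ≡⟨ letter-suc J (k + u) y y< ⟩
    letter (suc J) (k + u) y ⊕ letter (suc J) (suc (k + u)) (y / 2) ≡⟨ cong (_⊕ _) (agree u (m<n⇒m<1+n u<n)) ⟨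
    letter (suc J) (k + u) x ⊕ letter (suc J) (suc (k + u)) (y / 2) ∎)
    where
    shifted : letter (suc J) (suc (k + u)) x ≡ letter (suc J) (suc (k + u)) y
    shifted = subst (λ r → letter (suc J) r x ≡ letter (suc J) r y) (+-suc k u) (agree (suc u) (s≤s u<n))

  LettersAgree₀-/2 : ∀ s {x y} → x < 2 ^ suc J → y < 2 ^ suc J → parity x ≡ parity y →
                     LettersAgree 0 s x y → LettersAgree 0 s (x / 2) (y / 2)
  LettersAgree₀-/2 s {x} {y} x< y< bit agree zero    0<s = ℙ.+-cancelˡ-≡ (parity x) _ _ (begin
    parity x ⊕ letter (suc J) 0 (x / 2) ≡⟨ letter-zero J x x< ⟨
    letter (suc J) 0 x                  ≡⟨ agree 0 0<s ⟩
    letter (suc J) 0 y                  ≡⟨ letter-zero J y y< ⟩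
    parity y ⊕ letter (suc J) 0 (y / 2) ≡⟨ cong (_⊕ _) bit ⟨
    parity x ⊕ letter (suc J) 0 (y / 2) ∎)
  LettersAgree₀-/2 s {x} {y} x< y< bit agree (suc r) r<s = ℙ.+-cancelˡ-≡ (letter (suc J) r x) _ _ (begin
    letter (suc J) r x ⊕ letter (suc J) (suc r) (x / 2) ≡⟨ letter-suc J r x x< ⟨
    letter (suc J) (suc r) x                            ≡⟨ agree (suc r) r<s ⟩
    letter (suc J) (suc r) y                            ≡⟨ letter-suc J r y y< ⟩
    letter (suc J) r y ⊕ letter (suc J) (suc r) (y / 2) ≡⟨ cong (_⊕ _) (agree r (<-trans (n<1+n r) r<s)) ⟨
    letter (suc J) r x ⊕ letter (suc J) (suc r) (y / 2) ∎)

  LettersAgree-head : ∀ k {n x y} → LettersAgree k (suc n) x y → letter (suc J) k x ≡ letter (suc J) k y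
  LettersAgree-head k {x = x} {y} agree = subst (λ r → letter (suc J) r x ≡ letter (suc J) r y) (+-identityʳ k) (agree 0 z<s)

  lowBit-from-letter : ∀ k {x y} → parity (tailSum J k (x / 2)) ≡ parity (tailSum J k (y / 2)) →
                       letter (suc J) k x ≡ letter (suc J) k y → parity x ≡ parity y
  lowBit-from-letter k {x} {y} tails agree = ℙ.+-cancelʳ-≡ (parity (tailSum J k (x / 2))) _ _ (begin
    parity x ⊕ parity (tailSum J k (x / 2)) ≡⟨ letter-head J k x ⟨
    letter (suc J) k x                      ≡⟨ agree ⟩
    letter (suc J) k y                      ≡⟨ letter-head J k y ⟩
    parity y ⊕ parity (tailSum J k (y / 2)) ≡⟨ cong (parity y ⊕_) tails ⟨
    parity y ⊕ parity (tailSum J k (x / 2)) ∎)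

  letters⇒≡ : ∀ i k {x y} → x < 2 ^ suc J → y < 2 ^ suc J → x /2^ i ≡ y /2^ i → LettersAgree k i x y → x ≡ y
  letters⇒≡ zero    k {x} {y} _  _  high _     = trans (sym (n/1≡n x)) (trans high (n/1≡n y))
  letters⇒≡ (suc i) k {x} {y} x< y< high agree = parity≡∧/2≡⇒≡ bit half
    where
    half : x / 2 ≡ y / 2
    half = letters⇒≡ i (suc k) (m<n⇒m/2<n x<) (m<n⇒m/2<n y<) (/2^-suc-cong i high) (LettersAgree-/2 k i x< y< agree)
    bit : parity x ≡ parity y
    bit = lowBit-from-letter k (cong (λ z → parity (tailSum J k z)) half) (LettersAgree-head k agree)

  finalLetters⇒≡-mod : ∀ m a k {x y} → suc J ≡ 2 ^ m → k + a ≡ suc J → x < 2 ^ suc J → y < 2 ^ suc J →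
                       LettersAgree k a x y → x %2^ a ≡ y %2^ a
  finalLetters⇒≡-mod m zero    k {x} {y} _  _   _  _  _     = trans (n%1≡0 x) (sym (n%1≡0 y))
  finalLetters⇒≡-mod m (suc a) k {x} {y} 2^m k+a≡ x< y< agree = %2^-suc-join a bit low
    where
    low : (x / 2) %2^ a ≡ (y / 2) %2^ a
    low = finalLetters⇒≡-mod m a (suc k) 2^m (trans (sym (+-suc k a)) k+a≡) (m<n⇒m/2<n x<) (m<n⇒m/2<n y<)
            (LettersAgree-/2 k a x< y< agree)
    bit : parity x ≡ parity y
    bit = lowBit-from-letter k (tailSum-low m J k a (subst (J <_) 2^m (n<1+n J)) (trans k+a≡ 2^m) low)
            (LettersAgree-head k agree)

  initialLetters⇒≡ : ∀ a s {x y} → x < 2 ^ suc J → y < 2 ^ suc J → x %2^ a ≡ y %2^ a →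
                     x /2^ (a + s) ≡ y /2^ (a + s) → LettersAgree 0 s x y → x ≡ y
  initialLetters⇒≡ zero    s x< y< _   high agree = letters⇒≡ s 0 x< y< high agree
  initialLetters⇒≡ (suc a) s {x} {y} x< y< low high agree = parity≡∧/2≡⇒≡ bit
    (initialLetters⇒≡ a s (m<n⇒m/2<n x<) (m<n⇒m/2<n y<) low/2 (/2^-suc-cong (a + s) high)
       (LettersAgree₀-/2 s x< y< bit agree))
    where
    bit : parity x ≡ parity y
    bit = proj₁ (%2^-suc-split a low)
    low/2 : (x / 2) %2^ a ≡ (y / 2) %2^ a
    low/2 = proj₂ (%2^-suc-split a low)

d-<2 : ∀ m k x → d m k x < 2
d-<2 m k x = m%n<n (sumTo (2 ^ m) (λ j → p k j * e j x)) 2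

locate-<2 : ∀ m r f → locate m r f < 2
locate-<2 m r zero    = s≤s z≤n
locate-<2 m r (suc f) with r <ᵇ blockLen m
... | true  = d-<2 m (r %2^ m) (r /2^ m)
... | false = locate-<2 (suc m) (r ∸ blockLen m) f

digit-<2 : ∀ q → digit q < 2
digit-<2 q = locate-<2 1 q (suc q)

locate-here : ∀ m {r} f → r < blockLen m → locate m r (suc f) ≡ blockDigit m r
locate-here m {r} f r< with r <ᵇ blockLen m in eq
... | true  = refl
... | false = ⊥-elim (subst Bool.T eq (<⇒<ᵇ r<))

locate-pass : ∀ m r f → locate m (blockLen m + r) (suc f) ≡ locate (suc m) r f
locate-pass m r f with blockLen m + r <ᵇ blockLen m in eq
... | true  = ⊥-elim (m+n≮m (blockLen m) r (<ᵇ⇒< _ _ (subst Bool.T (sym eq) tt)))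
... | false = cong (λ q → locate (suc m) q f) (m+n∸m≡n (blockLen m) r)

locate-skip : ∀ k r f → locate 1 (nm (suc k) + r) (suc k + f) ≡ locate (suc k) r (suc f)
locate-skip zero    r f = refl
locate-skip (suc k) r f = begin
  locate 1 (nm (suc k) + blockLen (suc k) + r) (suc (suc k) + f)
    ≡⟨ cong₂ (locate 1) (+-assoc (nm (suc k)) _ r) (sym (+-suc (suc k) f)) ⟩
  locate 1 (nm (suc k) + (blockLen (suc k) + r)) (suc k + suc f) ≡⟨ locate-skip k (blockLen (suc k) + r) (suc f) ⟩
  locate (suc k) (blockLen (suc k) + r) (suc (suc f))            ≡⟨ locate-pass (suc k) r (suc f) ⟩
  locate (suc (suc k)) r (suc f)                                 ∎
  where open ≡-Reasoning

k≤nm[1+k] : ∀ k → k ≤ nm (suc k)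
k≤nm[1+k] zero    = z≤n
k≤nm[1+k] (suc k) = subst (_≤ nm (suc k) + blockLen (suc k)) (+-comm k 1)
                      (+-mono-≤ (k≤nm[1+k] k) (*-mono-≤ (m^n>0 2 (suc k)) (m^n>0 2 (2 ^ suc k))))

digit-in-block : ∀ m .{{_ : NonZero m}} {n j} → j < 2 ^ m → n < 2 ^ (2 ^ m) → digit (nm m + 2 ^ m * n + j) ≡ d m j n
digit-in-block (suc k) {n} {j} j< n< = begin
  digit (nm (suc k) + L * n + j)                  ≡⟨ cong digit (+-assoc (nm (suc k)) (L * n) j) ⟩
  locate 1 (nm (suc k) + r) (suc (nm (suc k) + r)) ≡⟨ cong (locate 1 (nm (suc k) + r)) fuel ⟩
  locate 1 (nm (suc k) + r) (suc k + f)           ≡⟨ locate-skip k r f ⟩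
  locate (suc k) r (suc f)                        ≡⟨ locate-here (suc k) f r< ⟩
  blockDigit (suc k) r                            ≡⟨ cong₂ (d (suc k)) (trans (cong (_%2^ suc k) r≡) ([m*n+o]%n≡o n L j<))
                                                                       (trans (cong (_/2^ suc k) r≡) ([m*n+o]/n≡m n L j<)) ⟩
  d (suc k) j n                                   ∎
  where
  open ≡-Reasoning
  L r f : ℕ
  L = 2 ^ suc k
  r = L * n + j
  f = nm (suc k) + r ∸ k
  instance
    L≢0 : NonZero L
    L≢0 = m^n≢0 2 (suc k)
  fuel : suc (nm (suc k) + r) ≡ suc k + f
  fuel = cong suc (sym (m+[n∸m]≡n (≤-trans (k≤nm[1+k] k) (m≤m+n (nm (suc k)) r))))
  r≡ : r ≡ n * L + j
  r≡ = cong (_+ j) (*-comm L n)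
  r< : r < blockLen (suc k)
  r< = <-≤-trans (+-monoʳ-< (L * n) j<)
                 (≤-trans (≤-reflexive (trans (+-comm (L * n) L) (sym (*-suc L n)))) (*-monoʳ-≤ L n<))

window-< : ∀ N i → window N i < 2 ^ i
window-< N zero    = s≤s z≤n
window-< N (suc i) = subst (_< 2 * 2 ^ i) (+-comm (window (suc N) i) (digit N * 2 ^ i))
  (<-≤-trans (+-monoˡ-< (digit N * 2 ^ i) (window-< (suc N) i)) (*-monoˡ-≤ (2 ^ i) (digit-<2 N)))

window-digits : ∀ i {N N'} → window N i ≡ window N' i → ∀ u → u < i → digit (N + u) ≡ digit (N' + u)
window-digits (suc i) {N} {N'} eq u u<
  with [m*n+o]-injective (2 ^ i) {digit N} {digit N'} {{m^n≢0 2 i}} (window-< (suc N) i) (window-< (suc N') i) eq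
window-digits (suc i) {N} {N'} eq zero    _         | first , _ =
  trans (cong digit (+-identityʳ N)) (trans first (cong digit (sym (+-identityʳ N'))))
window-digits (suc i) {N} {N'} eq (suc u) (s≤s u<i) | _ , rest =
  trans (cong digit (+-suc N u)) (trans (window-digits i rest u u<i) (cong digit (sym (+-suc N' u))))

-- Counting

𝟙 : ∀ {ℓ} {P : Set ℓ} → Dec P → ℕ
𝟙 d = if does d then 1 else 0

𝟙-≤1 : ∀ {ℓ} {P : Set ℓ} (d : Dec P) → 𝟙 d ≤ 1
𝟙-≤1 (yes _) = ≤-refl
𝟙-≤1 (no _)  = z≤n

𝟙-yes : ∀ {ℓ} {P : Set ℓ} (d : Dec P) → P → 𝟙 d ≡ 1
𝟙-yes (yes _) _ = refl
𝟙-yes (no ¬p) p = contradiction p ¬p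

𝟙-no : ∀ {ℓ} {P : Set ℓ} (d : Dec P) → ¬ P → 𝟙 d ≡ 0
𝟙-no (yes p) ¬p = contradiction p ¬p
𝟙-no (no _)  _  = refl

𝟙[_≡_] : ℕ → ℕ → ℕ
𝟙[ x ≡ y ] = 𝟙 (x ≟ y)

𝟙[_≢_] : ℕ → ℕ → ℕ
𝟙[ x ≢ y ] = 𝟙 (¬? (x ≟ y))

module _ {a ℓ} {A : Set a} {P : Pred A ℓ} (P? : Decidable P) where

  length-filter-[x] : ∀ x → length (filter P? [ x ]) ≡ 𝟙 (P? x)
  length-filter-[x] x with does (P? x)
  ... | true  = refl
  ... | false = refl

  length-filter-applyUpTo : ∀ (f : ℕ → A) n →
                            length (filter P? (applyUpTo f n)) ≡ sumTo n (λ j → 𝟙 (P? (f j)))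
  length-filter-applyUpTo f zero    = refl
  length-filter-applyUpTo f (suc n) = begin
    length (filter P? (applyUpTo f (suc n)))
      ≡⟨ cong (λ xs → length (filter P? xs)) (applyUpTo-∷ʳ f n) ⟨
    length (filter P? (applyUpTo f n ++ [ f n ]))               ≡⟨ cong length (filter-++ P? (applyUpTo f n) [ f n ]) ⟩
    length (filter P? (applyUpTo f n) ++ filter P? [ f n ])     ≡⟨ length-++ (filter P? (applyUpTo f n)) ⟩
    length (filter P? (applyUpTo f n)) + length (filter P? [ f n ])
      ≡⟨ cong₂ _+_ (length-filter-applyUpTo f n) (length-filter-[x] (f n)) ⟩
    sumTo n (λ j → 𝟙 (P? (f j))) + 𝟙 (P? (f n))                ∎
    where open ≡-Reasoning

module _ {a b ℓ} {A : Set a} {B : Set b} {P : Pred (A × B) ℓ} (P? : Decidable P) where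

  length-filter-cartesianProduct : ∀ (g : ℕ → A) (h : ℕ → B) K T →
    length (filter P? (cartesianProduct (applyUpTo g K) (applyUpTo h T)))
      ≡ sumTo K (λ k → sumTo T (λ t → 𝟙 (P? (g k , h t))))
  length-filter-cartesianProduct g h zero    T = refl
  length-filter-cartesianProduct g h (suc K) T = begin
    length (filter P? (cartesianProduct (applyUpTo g (suc K)) ys))
      ≡⟨ cong (λ xs → length (filter P? (cartesianProduct xs ys))) (applyUpTo-∷ʳ g K) ⟨
    length (filter P? (cartesianProduct (applyUpTo g K ++ [ g K ]) ys))
      ≡⟨ cong (λ zs → length (filter P? zs)) (cartesianProductWith-distribʳ-++ _,_ (applyUpTo g K) [ g K ] ys) ⟩
    length (filter P? (cartesianProduct (applyUpTo g K) ys ++ (map (g K ,_) ys ++ [])))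
      ≡⟨ cong (λ zs → length (filter P? (cartesianProduct (applyUpTo g K) ys ++ zs)))
              (trans (++-identityʳ (map (g K ,_) ys)) (map-applyUpTo h (g K ,_) T)) ⟩
    length (filter P? (cartesianProduct (applyUpTo g K) ys ++ applyUpTo (λ t → g K , h t) T))
      ≡⟨ cong length (filter-++ P? (cartesianProduct (applyUpTo g K) ys) _) ⟩
    length (filter P? (cartesianProduct (applyUpTo g K) ys) ++ filter P? (applyUpTo (λ t → g K , h t) T))
      ≡⟨ length-++ (filter P? (cartesianProduct (applyUpTo g K) ys)) ⟩
    length (filter P? (cartesianProduct (applyUpTo g K) ys)) + length (filter P? (applyUpTo (λ t → g K , h t) T))
      ≡⟨ cong₂ _+_ (length-filter-cartesianProduct g h K T) (length-filter-applyUpTo P? (λ t → g K , h t) T) ⟩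
    sumTo K (λ k → sumTo T (λ t → 𝟙 (P? (g k , h t)))) + sumTo T (λ t → 𝟙 (P? (g K , h t))) ∎
    where
    open ≡-Reasoning
    ys : List B
    ys = applyUpTo h T

𝟙[sum≢size]≤ : ∀ K (g : ℕ → ℕ) → 𝟙[ sumTo K g ≢ K ] ≤ sumTo K (λ k → 𝟙[ g k ≢ 1 ])
𝟙[sum≢size]≤ zero    g = z≤n
𝟙[sum≢size]≤ (suc K) g with g K ≟ 1
... | no  gK≢1 = ≤-trans (𝟙-≤1 (¬? (sumTo K g + g K ≟ suc K)))
                         (≤-trans (≤-reflexive (sym (𝟙-yes (¬? (g K ≟ 1)) gK≢1))) (m≤n+m _ _))
... | yes gK≡1 = ≤-trans (≤-reflexive (cong (λ v → 𝟙[ v ≢ suc K ]) (trans (cong (sumTo K g +_) gK≡1) (+-comm _ 1))))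
                         (≤-trans (𝟙[sum≢size]≤ K g) (m≤m+n _ _))

preimages : ℕ → (ℕ → ℕ) → ℕ → ℕ
preimages T f c = sumTo T (λ t → 𝟙[ f t ≡ c ])

preimages-injective-≤1 : ∀ n (f : ℕ → ℕ) c → (∀ t t' → t < n → t' < n → f t ≡ f t' → t ≡ t') →
                         preimages n f c ≤ 1
preimages-injective-≤1 zero    f c _   = z≤n
preimages-injective-≤1 (suc n) f c inj with f n ≟ c
... | yes fn≡c = ≤-reflexive (cong₂ _+_ (sumTo-zero n _ (λ t t<n → 𝟙-no (f t ≟ c)
                   (λ ft≡c → <-irrefl (inj t n (m<n⇒m<1+n t<n) (n<1+n n) (trans ft≡c (sym fn≡c))) t<n)))
                   (𝟙-yes (f n ≟ c) fn≡c))
... | no  fn≢c = subst (_≤ 1) (sym (trans (cong (preimages n f c +_) (𝟙-no (f n ≟ c) fn≢c)) (+-identityʳ _)))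
                   (preimages-injective-≤1 n f c (λ t t' t< t'< → inj t t' (m<n⇒m<1+n t<) (m<n⇒m<1+n t'<)))

sum-𝟙[y≡c] : ∀ n y → y < n → sumTo n (λ c → 𝟙[ y ≡ c ]) ≡ 1
sum-𝟙[y≡c] (suc n) y y< with y ≟ n
... | yes refl = cong₂ _+_ (sumTo-zero n _ (λ c c<y → 𝟙-no (y ≟ c) (λ y≡c → <-irrefl (sym y≡c) c<y)))
                          (𝟙-yes (y ≟ y) refl)
... | no  y≢n  = trans (cong (sumTo n (λ c → 𝟙[ y ≡ c ]) +_) (𝟙-no (y ≟ n) y≢n))
                       (trans (+-identityʳ _) (sum-𝟙[y≡c] n y (≤∧≢⇒< (s≤s⁻¹ y<) y≢n)))

sum-preimages : ∀ n T (f : ℕ → ℕ) → (∀ t → t < n → f t < T) → sumTo T (preimages n f) ≡ n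
sum-preimages n T f range = begin
  sumTo T (λ c → sumTo n (λ t → 𝟙[ f t ≡ c ])) ≡⟨ sumTo-swap T n (λ c t → 𝟙[ f t ≡ c ]) ⟩
  sumTo n (λ t → sumTo T (λ c → 𝟙[ f t ≡ c ]))
    ≡⟨ sumTo-cong n _ (λ _ → 1) (λ t t<n → sum-𝟙[y≡c] T (f t) (range t t<n)) ⟩
  sumTo n (λ _ → 1)                            ≡⟨ trans (sumTo-const n 1) (*-identityʳ n) ⟩
  n                                            ∎
  where open ≡-Reasoning

𝟙[a+δ≢1]≤ : ∀ a δ → a ≤ 1 → δ ≤ 1 → 𝟙[ a + δ ≢ 1 ] ≤ (1 ∸ a) + δ
𝟙[a+δ≢1]≤ 0 0 _ _ = ≤-refl
𝟙[a+δ≢1]≤ 0 1 _ _ = z≤n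
𝟙[a+δ≢1]≤ 1 0 _ _ = z≤n
𝟙[a+δ≢1]≤ 1 1 _ _ = ≤-refl
𝟙[a+δ≢1]≤ (suc (suc _)) _ (s≤s ()) _
𝟙[a+δ≢1]≤ _ (suc (suc _)) _ (s≤s ())

-- The first n values are distinct, so they miss exactly one c; the last value
-- either fills that gap or doubles up with one other c.
preimages≢1-≤2 : ∀ T (f : ℕ → ℕ) → (∀ t → t < T → f t < T) →
                 (∀ t t' → suc t < T → suc t' < T → f t ≡ f t' → t ≡ t') →
                 sumTo T (λ c → 𝟙[ preimages T f c ≢ 1 ]) ≤ 2
preimages≢1-≤2 zero    f _     _   = z≤n
preimages≢1-≤2 (suc n) f range inj = begin
  sumTo T (λ c → 𝟙[ a c + δ c ≢ 1 ])
    ≤⟨ sumTo-mono T _ _ (λ c _ → 𝟙[a+δ≢1]≤ (a c) (δ c) (a≤1 c) (𝟙-≤1 (f n ≟ c))) ⟩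
  sumTo T (λ c → (1 ∸ a c) + δ c)    ≡⟨ sumTo-+ T _ δ ⟩
  sumTo T (λ c → 1 ∸ a c) + sumTo T δ ≡⟨ cong₂ _+_ gaps (sum-𝟙[y≡c] T (f n) (range n (n<1+n n))) ⟩
  2                                  ∎
  where
  open ≤-Reasoning
  T : ℕ
  T = suc n
  a δ : ℕ → ℕ
  a = preimages n f
  δ c = 𝟙[ f n ≡ c ]
  a≤1 : ∀ c → a c ≤ 1
  a≤1 c = preimages-injective-≤1 n f c (λ t t' t< t'< → inj t t' (s≤s t<) (s≤s t'<))
  gaps : sumTo T (λ c → 1 ∸ a c) ≡ 1
  gaps = +-cancelʳ-≡ n _ 1 (begin-equality
    sumTo T (λ c → 1 ∸ a c) + n
      ≡⟨ cong (sumTo T (λ c → 1 ∸ a c) +_) (sum-preimages n T f (λ t t<n → range t (m<n⇒m<1+n t<n))) ⟨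
    sumTo T (λ c → 1 ∸ a c) + sumTo T a    ≡⟨ sumTo-+ T _ a ⟨
    sumTo T (λ c → 1 ∸ a c + a c)          ≡⟨ sumTo-cong T _ (λ _ → 1) (λ c _ → m∸n+n≡m (a≤1 c)) ⟩
    sumTo T (λ _ → 1)                      ≡⟨ trans (sumTo-const T 1) (*-identityʳ T) ⟩
    1 + n                                  ∎)

exceptional-values-≤ : ∀ K T (f : ℕ → ℕ → ℕ) → (∀ k t → k < K → t < T → f k t < T) →
  (∀ k t t' → k < K → suc t < T → suc t' < T → f k t ≡ f k t' → t ≡ t') →
  sumTo T (λ c → 𝟙[ sumTo K (λ k → preimages T (f k) c) ≢ K ]) ≤ K * 2
exceptional-values-≤ K T f range inj = begin
  sumTo T (λ c → 𝟙[ sumTo K (λ k → preimages T (f k) c) ≢ K ])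
    ≤⟨ sumTo-mono T _ _ (λ c _ → 𝟙[sum≢size]≤ K (λ k → preimages T (f k) c)) ⟩
  sumTo T (λ c → sumTo K (λ k → 𝟙[ preimages T (f k) c ≢ 1 ]))
    ≡⟨ sumTo-swap T K (λ c k → 𝟙[ preimages T (f k) c ≢ 1 ]) ⟩
  sumTo K (λ k → sumTo T (λ c → 𝟙[ preimages T (f k) c ≢ 1 ]))
    ≤⟨ sumTo-mono K _ (λ _ → 2) (λ k k<K → preimages≢1-≤2 T (f k) (λ t → range k t k<K) (λ t t' → inj k t t' k<K)) ⟩
  sumTo K (λ _ → 2)
    ≡⟨ sumTo-const K 2 ⟩
  K * 2 ∎
  where open ≤-Reasoning

-- Windows inside block m

module Block (m : ℕ) .{{_ : NonZero m}} where

  L J : ℕ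
  L = 2 ^ m
  J = L ∸ 1

  L≡1+J : L ≡ suc J
  L≡1+J = sym (m+[n∸m]≡n (m^n>0 2 m))

  at : ℕ → ℕ → ℕ
  at n k = nm m + L * n + k

  at-shift : ∀ n k u → at n k + u ≡ at n (k + u)
  at-shift n k u = +-assoc (nm m + L * n) k u

  at-next : ∀ n k a r → k + a ≡ L → at n k + (a + r) ≡ at (suc n) r
  at-next n k a r k+a≡L = subst (λ N → nm m + N * n + k + (a + r) ≡ nm m + N * suc n + r) k+a≡L
                                (carry (nm m) n k a r)
    where
    carry : ∀ A n k a r → A + (k + a) * n + k + (a + r) ≡ A + (k + a) * suc n + r
    carry = solve-∀

  letter-at : ∀ {n j} → j < L → n < 2 ^ suc J → parity (digit (at n j)) ≡ letter (suc J) j n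
  letter-at {n} {j} j< n< = begin
    parity (digit (at n j)) ≡⟨ cong parity (digit-in-block m j< (subst (λ N → n < 2 ^ N) (sym L≡1+J) n<)) ⟩
    parity (d m j n)        ≡⟨ parity-d m j n ⟩
    letter L j n            ≡⟨ cong (λ N → letter N j n) L≡1+J ⟩
    letter (suc J) j n      ∎
    where open ≡-Reasoning

  letters≡ : ∀ {x x' j N N'} → j < L → x < 2 ^ suc J → x' < 2 ^ suc J → N ≡ at x j → N' ≡ at x' j →
             parity (digit N) ≡ parity (digit N') → letter (suc J) j x ≡ letter (suc J) j x'
  letters≡ j< x< x'< refl refl eq = trans (sym (letter-at j< x<)) (trans eq (letter-at j< x'<))

  module Window {i B : ℕ} (i<L : i < L) (B< : B < 2 ^ (L ∸ i)) where

    word : ℕ → ℕ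
    word t = B * 2 ^ i + t

    word-< : ∀ {t} → t < 2 ^ i → word t < 2 ^ suc J
    word-< {t} t< = begin-strict
      B * 2 ^ i + t         <⟨ +-monoʳ-< (B * 2 ^ i) t< ⟩
      B * 2 ^ i + 2 ^ i     ≡⟨ +-comm (B * 2 ^ i) (2 ^ i) ⟩
      suc B * 2 ^ i         ≤⟨ *-monoˡ-≤ (2 ^ i) B< ⟩
      2 ^ (L ∸ i) * 2 ^ i   ≡⟨ ^-distribˡ-+-* 2 (L ∸ i) i ⟨
      2 ^ (L ∸ i + i)       ≡⟨ cong (2 ^_) (trans (m∸n+n≡m (<⇒≤ i<L)) L≡1+J) ⟩
      2 ^ suc J             ∎
      where open ≤-Reasoning

    word-high : ∀ {t} → t < 2 ^ i → word t /2^ i ≡ B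
    word-high t< = [m*n+o]/n≡m B (2 ^ i) {{m^n≢0 2 i}} t<

    suc-word : ∀ t → suc (word t) ≡ word (suc t)
    suc-word t = sym (+-suc (B * 2 ^ i) t)

    next-word-< : ∀ {t} → suc t < 2 ^ i → suc (word t) < 2 ^ suc J
    next-word-< {t} t+1< = subst (_< 2 ^ suc J) (sym (suc-word t)) (word-< t+1<)

    next-word-high : ∀ {t} → suc t < 2 ^ i → suc (word t) /2^ i ≡ B
    next-word-high {t} t+1< = trans (cong (_/2^ i) (suc-word t)) (word-high t+1<)

    window-parities : ∀ {n n' k} → window (at n k) i ≡ window (at n' k) i →
                      ∀ u → u < i → parity (digit (at n k + u)) ≡ parity (digit (at n' k + u))
    window-parities eq u u<i = cong parity (window-digits i eq u u<i)

    window-injective-inside : ∀ {k t t'} → k + i ≤ L → t < 2 ^ i → t' < 2 ^ i →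
                              window (at (word t) k) i ≡ window (at (word t') k) i → t ≡ t'
    window-injective-inside {k} {t} {t'} k+i≤L t< t'< eq = +-cancelˡ-≡ (B * 2 ^ i) t t'
      (letters⇒≡ J i k (word-< t<) (word-< t'<) (trans (word-high t<) (sym (word-high t'<)))
        (λ u u<i → letters≡ (<-≤-trans (+-monoʳ-< k u<i) k+i≤L) (word-< t<) (word-< t'<)
                     (at-shift (word t) k u) (at-shift (word t') k u) (window-parities eq u u<i)))

    -- The first a letters of the window are the last letters of word t, which fix it modulo 2 ^ a;
    -- the remaining s letters are the first letters of word (t + 1).
    window-injective-straddling : ∀ {k t t'} → k < L → L < k + i → suc t < 2 ^ i → suc t' < 2 ^ i →
                                  window (at (word t) k) i ≡ window (at (word t') k) i → t ≡ t'
    window-injective-straddling {k} {t} {t'} k<L L<k+i t+1< t'+1< eq =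
      +-cancelˡ-≡ (B * 2 ^ i) t t' (suc-injective next≡)
      where
      a s : ℕ
      a = L ∸ k
      s = i ∸ a
      k+a≡L : k + a ≡ L
      k+a≡L = m+[n∸m]≡n (<⇒≤ k<L)
      a≤i : a ≤ i
      a≤i = <⇒≤ (+-cancelˡ-< k a i (subst (_< k + i) (sym k+a≡L) L<k+i))
      a+s≡i : a + s ≡ i
      a+s≡i = m+[n∸m]≡n a≤i
      t< : t < 2 ^ i
      t< = <-trans (n<1+n t) t+1<
      t'< : t' < 2 ^ i
      t'< = <-trans (n<1+n t') t'+1<
      low : word t %2^ a ≡ word t' %2^ a
      low = finalLetters⇒≡-mod J m a k (sym L≡1+J) (trans k+a≡L L≡1+J) (word-< t<) (word-< t'<)
        (λ u u<a → letters≡ (subst (k + u <_) k+a≡L (+-monoʳ-< k u<a)) (word-< t<) (word-< t'<)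
                     (at-shift (word t) k u) (at-shift (word t') k u) (window-parities eq u (<-≤-trans u<a a≤i)))
      high : suc (word t) /2^ (a + s) ≡ suc (word t') /2^ (a + s)
      high = subst (λ q → suc (word t) /2^ q ≡ suc (word t') /2^ q) (sym a+s≡i)
                   (trans (next-word-high t+1<) (sym (next-word-high t'+1<)))
      next≡ : suc (word t) ≡ suc (word t')
      next≡ = initialLetters⇒≡ J a s (next-word-< t+1<) (next-word-< t'+1<) (%2^-cong-suc a low) high
        (λ r r<s → letters≡ (<-trans (≤-<-trans (m≤n+m r a) (a+r<i r<s)) i<L) (next-word-< t+1<) (next-word-< t'+1<)
                     (at-next (word t) k a r k+a≡L) (at-next (word t') k a r k+a≡L) (window-parities eq (a + r) (a+r<i r<s)))
        where
        a+r<i : ∀ {r} → r < s → a + r < i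
        a+r<i r<s = subst (a + _ <_) a+s≡i (+-monoʳ-< a r<s)

    window-injective : ∀ k t t' → k < L → suc t < 2 ^ i → suc t' < 2 ^ i →
                       window (at (word t) k) i ≡ window (at (word t') k) i → t ≡ t'
    window-injective k t t' k<L t+1< t'+1< with k + i ≤? L
    ... | yes k+i≤L = window-injective-inside k+i≤L (<-trans (n<1+n t) t+1<) (<-trans (n<1+n t') t'+1<)
    ... | no  k+i≰L = window-injective-straddling k<L (≰⇒> k+i≰L) t+1< t'+1<

lemma2 : (m : ℕ) → 1 ≤ m → (i : ℕ) → i < 2 ^ m → (B : ℕ) → B < 2 ^ (2 ^ m ∸ i) →
    exceptions m i B ≤ 2 ^ (m + 1)
lemma2 m 1≤m i i<L B B< = begin
  exceptions m i B
    ≡⟨ length-filter-applyUpTo (λ c → ¬? (count m i B c ≟ 2 ^ m)) (λ c → c) (2 ^ i) ⟩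
  sumTo (2 ^ i) (λ c → 𝟙[ count m i B c ≢ 2 ^ m ])
    ≡⟨ sumTo-cong (2 ^ i) _ _ (λ c _ → cong (λ n → 𝟙[ n ≢ 2 ^ m ]) (count≡ c)) ⟩
  sumTo (2 ^ i) (λ c → 𝟙[ sumTo (2 ^ m) (λ k → preimages (2 ^ i) (f k) c) ≢ 2 ^ m ])
    ≤⟨ exceptional-values-≤ (2 ^ m) (2 ^ i) f (λ k t _ _ → window-< (at (word t) k) i) window-injective ⟩
  2 ^ m * 2
    ≡⟨ ^-distribˡ-+-* 2 m 1 ⟨
  2 ^ (m + 1) ∎
  where
  open ≤-Reasoning
  instance
    m≢0 : NonZero m
    m≢0 = >-nonZero 1≤m
  open Block m
  open Block.Window m i<L B<
  f : ℕ → ℕ → ℕ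
  f k t = window (at (word t) k) i
  count≡ : ∀ c → count m i B c ≡ sumTo (2 ^ m) (λ k → preimages (2 ^ i) (f k) c)
  count≡ c = length-filter-cartesianProduct (λ kn → inInterval? (nm m + 2 ^ m * proj₂ kn + proj₁ kn) i c)
               (λ k → k) word (2 ^ m) (2 ^ i)
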